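{- Let $n\ge 2$ and let $i,j,r,s\in\{0,1,\ldots,n-1\}$ with $i\ne j$, $r\ne s$. Suppose $p\sim_n|10^i-10^j|$ and $q\sim_n|10^r-10^s|$ with $p\neq q$. Then $p+q\in C(n-1)$ if and only if $|\{i,j\}\cap\{r,s\}|=1$. Moreover, in that case $p+q\sim_n|10^x-10^y|$, where $x\in\{i,j\}$, $y\in\{r,s\}$ and $x,y\notin\{i,j\}\cap\{r,s\}$.
   Context: $C(n-1)$ is the set of non-zero vectors in $\mathbb{Z}_2^{n-1}$ whose $1$'s occupy consecutive coordinates. Notation: for distinct $a,b\in\{0,\ldots,n-1\}$, $p\sim_n|10^a-10^b|$ means that $p\in\mathbb{Z}_2^{n-1}$ is the vector with $1$'s exactly in the coordinates $k$ (from the left) with $n-\max(a,b)\le k\le n-\min(a,b)-1$ and $0$ elsewhere; this is the code of the edge joining vertices $10^a$ and $10^b$ of a graph with vertices labelled $1,10,\ldots,10^{n-1}$. -}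

module Defs where

open import Data.Nat using (ℕ; zero; suc; _+_; _∸_; _≤_; _<_; _⊔_; _⊓_; _≟_)
open import Data.Nat.Properties using (_≤?_)
open import Data.Bool using (Bool; true; false; _xor_; _∧_)
open import Data.Vec using (Vec; tabulate; zipWith; lookup; replicate)
open import Data.Fin using (Fin; toℕ)
open import Data.List using (List; []; _∷_; length; filter)
open import Data.List.Membership.Propositional using (_∈_)
open import Data.Product using (Σ; _×_; ∃; ∃-syntax)
open import Relation.Nullary using (¬_)
open import Relation.Nullary.Decidable using (⌊_⌋; _⊎-dec_)
open import Relation.Binary.PropositionalEquality using (_≡_)

-- Vectors in Z_2^(n-1) are represented as Vec Bool (n ∸ 1).
-- Coordinates are numbered from the left starting at 1: the entry at
-- position t : Fin (n ∸ 1) is coordinate k = toℕ t + 1.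

Z2vec : ℕ → Set
Z2vec n = Vec Bool (n ∸ 1)

_⊕_ : ∀ {m} → Vec Bool m → Vec Bool m → Vec Bool m
_⊕_ = zipWith _xor_

edgeCode : (n a b : ℕ) → Z2vec n
edgeCode n a b = tabulate λ t →
  ⌊ (n ∸ (a ⊔ b)) ≤? suc (toℕ t) ⌋ ∧ ⌊ suc (toℕ t) ≤? (n ∸ (a ⊓ b) ∸ 1) ⌋

[_]_∼∣10^_-10^_∣ : (n : ℕ) → Z2vec n → (a b : ℕ) → Set
[ n ] p ∼∣10^ a -10^ b ∣ =
  a < n × b < n × ¬ (a ≡ b) × p ≡ edgeCode n a b

zeroVec : ∀ {m} → Vec Bool m
zeroVec = replicate _ false

C : (m : ℕ) → Vec Bool m → Set
C m v = ¬ (v ≡ zeroVec) ×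
  ∃[ l ] ∃[ u ] (∀ (t : Fin m) →
     (lookup v t ≡ true → l ≤ suc (toℕ t) × suc (toℕ t) ≤ u) ×
     (l ≤ suc (toℕ t) × suc (toℕ t) ≤ u → lookup v t ≡ true))

-- {i,j} ∩ {r,s} as a list without duplicates (assuming i ≠ j)
inter : (i j r s : ℕ) → List ℕ
inter i j r s = filter (λ x → (x ≟ r) ⊎-dec (x ≟ s)) (i ∷ j ∷ [])

module Submission where

-- Read position t (coordinate k = t+1) of a vector in Z₂^(n-1) at the level
-- J = n - k.  The code of the edge 10^a — 10^b has a 1 at level J exactly when
-- the edge crosses J, i.e. when exactly one of a, b lies below J: the entry
-- is [a < J] xor [b < J]  (edgeCode-lookup).  So the sum of two edge codes is,
-- levelwise, the xor of four such thresholds (edgeSum-lookup), and: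
--  * a common endpoint w cancels: |10^w-10^x| + |10^w-10^y| is the code of
--    |10^x-10^y|, which lies in C  (edgeCode-shared, edgeCode∈C);
--  * four distinct endpoints e₁ < e₂ < e₃ < e₄ give the values 1, 0, 1 at the
--    levels e₁+1, e₂+1, e₃+1, so the 1's are not consecutive  (gap-disjoint,
--    gap⇒¬C);
--  * equal endpoint sets give equal codes, excluded by p ≠ q.

open import Defs
open import Data.Nat using (ℕ; suc; _<_; _∸_)
open import Data.List using (length)
open import Data.List.Membership.Propositional using (_∈_; _∉_)
open import Data.List using ([]; _∷_)
open import Data.Product using (_×_; ∃-syntax)
open import Relation.Nullary using (¬_)
open import Relation.Binary.PropositionalEquality using (_≡_)
open import Function.Bundles using (_⇔_)

open import Data.Nat using (_+_; _≤_; _⊔_; _⊓_; _≟_; z≤n; s≤s; s≤s⁻¹)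
open import Data.Nat.Properties
open import Data.Bool using (Bool; true; false; not; _∧_; _∨_; _xor_)
open import Data.Bool.Properties using (∧-comm; xor-is-ok; xor-comm; xor-same; xor-∧-commutativeRing)
open import Algebra.Bundles using (CommutativeRing)
open import Algebra.Properties.CommutativeSemigroup
  (CommutativeRing.+-commutativeSemigroup xor-∧-commutativeRing) using (interchange)
open import Data.Vec using (Vec; lookup; tabulate)
open import Data.Vec.Properties using (lookup-zipWith; lookup∘tabulate; tabulate∘lookup; tabulate-cong; lookup-replicate)
open import Data.Fin using (Fin; toℕ; fromℕ<)
open import Data.Fin.Properties using (toℕ-fromℕ<; toℕ<n)
open import Data.List.Properties using (filter-accept; filter-reject)
open import Data.List.Relation.Unary.Any using (here; there)
open import Data.Product using (_,_; Σ; proj₁; proj₂)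
open import Data.Sum using (_⊎_; inj₁; inj₂; [_,_])
import Data.Sum as Sum
open import Data.Empty using (⊥-elim)
open import Relation.Nullary using (Dec; yes; no)
open import Relation.Nullary.Decidable using (⌊_⌋; does; isYes≗does; does-⇔; dec-true; dec-false; ¬?; _×-dec_; _⊎-dec_)
open import Relation.Binary.PropositionalEquality using (_≢_; _≗_; refl; sym; trans; cong; cong₂; subst; subst₂; module ≡-Reasoning)
open import Relation.Binary.Definitions using (tri<; tri≈; tri>)
open import Function.Bundles using (mk⇔; Equivalence)
open import Function.Base using (_∘_)

private
  variable
    n a b c d w x y J : ℕ

below : ℕ → ℕ → Bool
below c J = does (c <? J)

below-true : c < J → below c J ≡ true
below-true {c} {J} c<J = dec-true (c <? J) c<J

below-false : J ≤ c → below c J ≡ false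
below-false {J} {c} J≤c = dec-false (c <? J) (≤⇒≯ J≤c)

crosses : ℕ → ℕ → ℕ → Bool
crosses a b J = below a J xor below b J

crossParity : ℕ → ℕ → ℕ → ℕ → ℕ → Bool
crossParity a b c d J = crosses a b J xor crosses c d J

crossParity-at : ∀ {a b c d J α β γ δ} → below a J ≡ α → below b J ≡ β → below c J ≡ γ → below d J ≡ δ →
  crossParity a b c d J ≡ (α xor β) xor (γ xor δ)
crossParity-at refl refl refl refl = refl

crosses-top : a < b → crosses a b b ≡ true
crosses-top {a} {b} a<b = cong₂ _xor_ (below-true a<b) (below-false (≤-refl {b}))

level : (n : ℕ) → Fin (n ∸ 1) → ℕ
level n t = n ∸ suc (toℕ t)

true≢false : true ≢ false
true≢false ()

⌊⌋-⇔ : ∀ {A B : Set} → A ⇔ B → (a? : Dec A) (b? : Dec B) → ⌊ a? ⌋ ≡ does b?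
⌊⌋-⇔ A⇔B a? b? = trans (isYes≗does a?) (does-⇔ A⇔B a? b?)

⌊⌋∧⌊⌋≡true : ∀ {A B : Set} (a? : Dec A) (b? : Dec B) → (⌊ a? ⌋ ∧ ⌊ b? ⌋ ≡ true) ⇔ (A × B)
⌊⌋∧⌊⌋≡true (yes a) (yes b) = mk⇔ (λ _ → a , b) (λ _ → refl)
⌊⌋∧⌊⌋≡true (yes _) (no ¬b) = mk⇔ (λ ()) (λ (_ , b) → ⊥-elim (¬b b))
⌊⌋∧⌊⌋≡true (no ¬a) _       = mk⇔ (λ ()) (λ (a , _) → ⊥-elim (¬a a))

lower-bound : ∀ k J c → ((k + J) ∸ c ≤ k) ⇔ (¬ c < J)
lower-bound k J c = mk⇔
  (λ n∸c≤k c<J → <⇒≱ (m+n≤o⇒m≤o∸n (suc k) (+-monoʳ-< k c<J)) n∸c≤k)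
  (λ c≮J → begin
    (k + J) ∸ c  ≤⟨ ∸-monoʳ-≤ (k + J) (≮⇒≥ c≮J) ⟩
    (k + J) ∸ J  ≡⟨ m+n∸n≡m k J ⟩
    k            ∎)
  where open ≤-Reasoning

upper-bound : ∀ k J c → c < k + J → (k ≤ (k + J) ∸ c ∸ 1) ⇔ (c < J)
upper-bound k J c c<n = mk⇔
  (λ k≤ → +-cancelˡ-≤ k (suc c) J (m≤o∸n⇒m+n≤o k c<n (subst (k ≤_) ∸-suc k≤)))
  (λ c<J → subst (k ≤_) (sym ∸-suc) (m+n≤o⇒m≤o∸n k (+-monoʳ-≤ k c<J)))
  where
  ∸-suc : (k + J) ∸ c ∸ 1 ≡ (k + J) ∸ suc c
  ∸-suc = trans (∸-+-assoc (k + J) c 1) (cong ((k + J) ∸_) (+-comm c 1))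

⊔<⇔ : ∀ a b J → (a ⊔ b < J) ⇔ (a < J × b < J)
⊔<⇔ a b J = mk⇔ (λ h → m⊔n<o⇒m<o a b h , m⊔n<o⇒n<o a b h) (λ (a<J , b<J) → ⊔-lub a<J b<J)

⊓<⇔ : ∀ a b J → (a ⊓ b < J) ⇔ (a < J ⊎ b < J)
⊓<⇔ a b J = mk⇔
  (λ h → Sum.map (λ e → subst (_< J) e h) (λ e → subst (_< J) e h) (⊓-sel a b))
  [ ≤-<-trans (m⊓n≤m a b) , ≤-<-trans (m⊓n≤n a b) ]

entry : ℕ → ℕ → ℕ → ℕ → Bool
entry n a b k = ⌊ (n ∸ (a ⊔ b)) ≤? k ⌋ ∧ ⌊ k ≤? (n ∸ (a ⊓ b) ∸ 1) ⌋

entry-crosses : ∀ k J → k + J ≡ n → a < n → b < n → entry n a b k ≡ crosses a b J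
entry-crosses {a = a} {b} k J refl a<n b<n = begin
  entry (k + J) a b k
    ≡⟨ cong₂ _∧_ (⌊⌋-⇔ (lower-bound k J (a ⊔ b)) ((k + J) ∸ (a ⊔ b) ≤? k) (¬? (a ⊔ b <? J)))
                 (⌊⌋-⇔ (upper-bound k J (a ⊓ b) (≤-<-trans (m⊓n≤m a b) a<n))
                       (k ≤? (k + J) ∸ (a ⊓ b) ∸ 1) (a ⊓ b <? J)) ⟩
  not (does (a ⊔ b <? J)) ∧ does (a ⊓ b <? J)
    ≡⟨ cong₂ (λ u v → not u ∧ v) (does-⇔ (⊔<⇔ a b J) (a ⊔ b <? J) (a <? J ×-dec b <? J))
                                 (does-⇔ (⊓<⇔ a b J) (a ⊓ b <? J) (a <? J ⊎-dec b <? J)) ⟩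
  not (below a J ∧ below b J) ∧ (below a J ∨ below b J)
    ≡⟨ ∧-comm (not (below a J ∧ below b J)) (below a J ∨ below b J) ⟩
  (below a J ∨ below b J) ∧ not (below a J ∧ below b J)
    ≡⟨ xor-is-ok (below a J) (below b J) ⟨
  crosses a b J ∎
  where open ≡-Reasoning

edgeCode-lookup : a < n → b < n → (t : Fin (n ∸ 1)) →
  lookup (edgeCode n a b) t ≡ crosses a b (level n t)
edgeCode-lookup {a} {n} {b} a<n b<n t = begin
  lookup (edgeCode n a b) t     ≡⟨ lookup∘tabulate (λ s → entry n a b (suc (toℕ s))) t ⟩
  entry n a b (suc (toℕ t))     ≡⟨ entry-crosses (suc (toℕ t)) (level n t) (m+[n∸m]≡n k≤n) a<n b<n ⟩
  crosses a b (level n t)       ∎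
  where
  open ≡-Reasoning
  k≤n : suc (toℕ t) ≤ n
  k≤n = ≤-trans (toℕ<n t) (m∸n≤m n 1)

edgeSum-lookup : a < n → b < n → c < n → d < n → (t : Fin (n ∸ 1)) →
  lookup (edgeCode n a b ⊕ edgeCode n c d) t ≡ crossParity a b c d (level n t)
edgeSum-lookup {a} {n} {b} {c} {d} a<n b<n c<n d<n t =
  trans (lookup-zipWith _xor_ t (edgeCode n a b) (edgeCode n c d))
        (cong₂ _xor_ (edgeCode-lookup a<n b<n t) (edgeCode-lookup c<n d<n t))

vec-ext : ∀ {m} {u v : Vec Bool m} → (∀ t → lookup u t ≡ lookup v t) → u ≡ v
vec-ext {u = u} {v} h = trans (sym (tabulate∘lookup u)) (trans (tabulate-cong h) (tabulate∘lookup v))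

edgeCode-sym : ∀ n a b → edgeCode n a b ≡ edgeCode n b a
edgeCode-sym n a b = cong₂ tabulate-code (⊔-comm a b) (⊓-comm a b)
  where
  tabulate-code : ℕ → ℕ → Z2vec n
  tabulate-code M m = tabulate λ t → ⌊ (n ∸ M) ≤? suc (toℕ t) ⌋ ∧ ⌊ suc (toℕ t) ≤? (n ∸ m ∸ 1) ⌋

-- Two edges with a common endpoint w add up to the edge joining the other
-- endpoints: the two crossings of w cancel.
edgeCode-shared : w < n → x < n → y < n →
  edgeCode n w x ⊕ edgeCode n w y ≡ edgeCode n x y
edgeCode-shared {w} {n} {x} {y} w<n x<n y<n = vec-ext λ t → begin
  lookup (edgeCode n w x ⊕ edgeCode n w y) t
    ≡⟨ edgeSum-lookup w<n x<n w<n y<n t ⟩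
  (below w (level n t) xor below x (level n t)) xor (below w (level n t) xor below y (level n t))
    ≡⟨ interchange (below w (level n t)) (below x (level n t)) (below w (level n t)) (below y (level n t)) ⟩
  (below w (level n t) xor below w (level n t)) xor crosses x y (level n t)
    ≡⟨ cong (_xor crosses x y (level n t)) (xor-same (below w (level n t))) ⟩
  crosses x y (level n t)
    ≡⟨ edgeCode-lookup x<n y<n t ⟨
  lookup (edgeCode n x y) t ∎
  where open ≡-Reasoning

position : ∀ {k} → 1 ≤ k → k < n → Σ (Fin (n ∸ 1)) λ t → suc (toℕ t) ≡ k
position {suc n} {suc k} _ (s≤s k<n) = fromℕ< k<n , cong suc (toℕ-fromℕ< k<n)

position-at-level : 1 ≤ J → J < n → Σ (Fin (n ∸ 1)) λ t → suc (toℕ t) ≡ n ∸ J × level n t ≡ J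
position-at-level {J} {n} 1≤J J<n with position (m<n⇒0<n∸m J<n) (∸-monoʳ-< 1≤J (<⇒≤ J<n))
... | t , k≡n∸J = t , k≡n∸J , trans (cong (n ∸_) k≡n∸J) (m∸[m∸n]≡n (<⇒≤ J<n))

C-convex : ∀ {m} {v : Vec Bool m} {s t u : Fin m} → C m v →
  lookup v s ≡ true → lookup v u ≡ true → toℕ s ≤ toℕ t → toℕ t ≤ toℕ u → lookup v t ≡ true
C-convex (_ , _ , _ , interval) v-s v-u s≤t t≤u =
  proj₂ (interval _) ( ≤-trans (proj₁ (proj₁ (interval _) v-s)) (s≤s s≤t)
                     , ≤-trans (s≤s t≤u) (proj₂ (proj₁ (interval _) v-u)))

-- The code of an edge with a < b is non-zero: it has a 1 at level b.
edgeCode≢0 : a < b → b < n → edgeCode n a b ≢ zeroVec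
edgeCode≢0 {a} {b} {n} a<b b<n code≡0 with position-at-level (≤-trans (s≤s z≤n) a<b) b<n
... | t , _ , level≡b = true≢false (begin
  true                      ≡⟨ crosses-top a<b ⟨
  crosses a b b             ≡⟨ cong (crosses a b) level≡b ⟨
  crosses a b (level n t)   ≡⟨ edgeCode-lookup (<-trans a<b b<n) b<n t ⟨
  lookup (edgeCode n a b) t ≡⟨ cong (λ v → lookup v t) code≡0 ⟩
  lookup zeroVec t          ≡⟨ lookup-replicate t false ⟩
  false                     ∎)
  where
  open ≡-Reasoning

edgeCode∈C : a < n → b < n → a ≢ b → C (n ∸ 1) (edgeCode n a b)
edgeCode∈C {a} {n} {b} a<n b<n a≢b = nonzero , n ∸ (a ⊔ b) , n ∸ (a ⊓ b) ∸ 1 , λ t →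
  let entry-t = lookup∘tabulate (λ s → entry n a b (suc (toℕ s))) t
      bounds⇔ = ⌊⌋∧⌊⌋≡true (n ∸ (a ⊔ b) ≤? suc (toℕ t)) (suc (toℕ t) ≤? n ∸ (a ⊓ b) ∸ 1)
  in (λ v-t → Equivalence.to bounds⇔ (trans (sym entry-t) v-t))
   , (λ bounds → trans entry-t (Equivalence.from bounds⇔ bounds))
  where
  nonzero : edgeCode n a b ≢ zeroVec
  nonzero with <-cmp a b
  ... | tri< a<b _ _ = edgeCode≢0 a<b b<n
  ... | tri≈ _ a≡b _ = ⊥-elim (a≢b a≡b)
  ... | tri> _ _ b<a = subst (_≢ zeroVec) (edgeCode-sym n b a) (edgeCode≢0 b<a a<n)

record Gap (n : ℕ) (f : ℕ → Bool) : Set where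
  field
    J₁ J₂ J₃ : ℕ
    1≤J₁     : 1 ≤ J₁
    J₁≤J₂    : J₁ ≤ J₂
    J₂≤J₃    : J₂ ≤ J₃
    J₃<n     : J₃ < n
    f-J₁     : f J₁ ≡ true
    f-J₂     : f J₂ ≡ false
    f-J₃     : f J₃ ≡ true

gap-resp : ∀ {f g : ℕ → Bool} → f ≗ g → Gap n g → Gap n f
gap-resp f≗g gap = record
  { J₁ = J₁ ; J₂ = J₂ ; J₃ = J₃ ; 1≤J₁ = 1≤J₁ ; J₁≤J₂ = J₁≤J₂ ; J₂≤J₃ = J₂≤J₃ ; J₃<n = J₃<n
  ; f-J₁ = trans (f≗g J₁) f-J₁ ; f-J₂ = trans (f≗g J₂) f-J₂ ; f-J₃ = trans (f≗g J₃) f-J₃ }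
  where open Gap gap

-- A vector whose levelwise pattern has a gap has a 0 between two 1's (at
-- coordinates n - J₃ ≤ n - J₂ ≤ n - J₁), so it is not in C.
gap⇒¬C : ∀ {f} (v : Z2vec n) → (∀ t → lookup v t ≡ f (level n t)) → Gap n f → ¬ C (n ∸ 1) v
gap⇒¬C {n} {f} v v≡f gap v∈C = true≢false (trans (sym v-t₂≡true) (value pos₂ f-J₂))
  where
  open Gap gap
  PositionAt : ℕ → Set
  PositionAt J = Σ (Fin (n ∸ 1)) λ t → suc (toℕ t) ≡ n ∸ J × level n t ≡ J
  pos₁ : PositionAt J₁
  pos₁ = position-at-level 1≤J₁ (≤-<-trans J₁≤J₂ (≤-<-trans J₂≤J₃ J₃<n))
  pos₂ : PositionAt J₂
  pos₂ = position-at-level (≤-trans 1≤J₁ J₁≤J₂) (≤-<-trans J₂≤J₃ J₃<n)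
  pos₃ : PositionAt J₃
  pos₃ = position-at-level (≤-trans 1≤J₁ (≤-trans J₁≤J₂ J₂≤J₃)) J₃<n
  value : ∀ {J β} (pos : PositionAt J) → f J ≡ β → lookup v (proj₁ pos) ≡ β
  value (t , _ , lv) fJ = trans (v≡f t) (trans (cong f lv) fJ)
  coordinate-≥ : ∀ {J J′} (pos : PositionAt J) (pos′ : PositionAt J′) → J ≤ J′ →
    toℕ (proj₁ pos′) ≤ toℕ (proj₁ pos)
  coordinate-≥ (_ , k , _) (_ , k′ , _) J≤J′ = s≤s⁻¹ (subst₂ _≤_ (sym k′) (sym k) (∸-monoʳ-≤ n J≤J′))
  v-t₂≡true : lookup v (proj₁ pos₂) ≡ true
  v-t₂≡true = C-convex v∈C (value pos₃ f-J₃) (value pos₁ f-J₁)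
    (coordinate-≥ pos₂ pos₃ J₂≤J₃) (coordinate-≥ pos₁ pos₂ J₁≤J₂)

-- For sorted endpoints e₁ < e₂ < e₃ < e₄ the pattern reads 1, 0, 1 at the
-- levels e₁+1, e₂+1, e₃+1 (one, two, three endpoints below).
gap-sorted : ∀ {e₁ e₂ e₃ e₄} → e₁ < e₂ → e₂ < e₃ → e₃ < e₄ → e₄ < n →
  Gap n (crossParity e₁ e₂ e₃ e₄)
gap-sorted {n} {e₁} {e₂} {e₃} {e₄} e₁<e₂ e₂<e₃ e₃<e₄ e₄<n = record
  { J₁ = suc e₁ ; J₂ = suc e₂ ; J₃ = suc e₃
  ; 1≤J₁ = s≤s z≤n ; J₁≤J₂ = s≤s (<⇒≤ e₁<e₂) ; J₂≤J₃ = s≤s (<⇒≤ e₂<e₃)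
  ; J₃<n = ≤-trans (s≤s e₃<e₄) e₄<n
  ; f-J₁ = value (suc e₁) (below-true (n<1+n e₁)) (below-false e₁<e₂)
                (below-false e₁<e₃) (below-false e₁<e₄)
  ; f-J₂ = value (suc e₂) (below-true (m<n⇒m<1+n e₁<e₂)) (below-true (n<1+n e₂))
                (below-false e₂<e₃) (below-false e₂<e₄)
  ; f-J₃ = value (suc e₃) (below-true (m<n⇒m<1+n e₁<e₃)) (below-true (m<n⇒m<1+n e₂<e₃))
                (below-true (n<1+n e₃)) (below-false e₃<e₄)
  }
  where
  value : ∀ J {α β γ δ} → below e₁ J ≡ α → below e₂ J ≡ β → below e₃ J ≡ γ → below e₄ J ≡ δ →
    crossParity e₁ e₂ e₃ e₄ J ≡ (α xor β) xor (γ xor δ)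
  value J = crossParity-at {e₁} {e₂} {e₃} {e₄} {J}
  e₁<e₃ = <-trans e₁<e₂ e₂<e₃
  e₂<e₄ = <-trans e₂<e₃ e₃<e₄
  e₁<e₄ = <-trans e₁<e₃ e₃<e₄

crossParity-interchange : ∀ a b c d → crossParity a b c d ≗ crossParity a c b d
crossParity-interchange a b c d J = interchange (below a J) (below b J) (below c J) (below d J)

crossParity-swap : ∀ a b c d → crossParity a b c d ≗ crossParity c d a b
crossParity-swap a b c d J = xor-comm (crosses a b J) (crosses c d J)

crossParity-flipˡ : ∀ a b c d → crossParity a b c d ≗ crossParity b a c d
crossParity-flipˡ a b c d J = cong (_xor crosses c d J) (xor-comm (below a J) (below b J))

crossParity-flipʳ : ∀ a b c d → crossParity a b c d ≗ crossParity a b d c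
crossParity-flipʳ a b c d J = cong (crosses a b J xor_) (xor-comm (below c J) (below d J))

gap-ordered : a < b → c < d → a < c → b < n → d < n → b ≢ c → b ≢ d → Gap n (crossParity a b c d)
gap-ordered {a} {b} {c} {d} a<b c<d a<c b<n d<n b≢c b≢d with <-cmp b c | <-cmp b d
... | tri< b<c _ _ | _            = gap-sorted a<b b<c c<d d<n
... | tri≈ _ b≡c _ | _            = ⊥-elim (b≢c b≡c)
... | tri> _ _ c<b | tri< b<d _ _ =
  gap-resp (crossParity-interchange a b c d) (gap-sorted a<c c<b b<d d<n)
... | tri> _ _ _   | tri≈ _ b≡d _ = ⊥-elim (b≢d b≡d)
... | tri> _ _ _   | tri> _ _ d<b =
  gap-resp (λ J → trans (crossParity-interchange a b c d J) (crossParity-flipʳ a c b d J))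
           (gap-sorted a<c c<d d<b b<n)

gap-oriented : a < b → c < d → b < n → d < n → a ≢ c → a ≢ d → b ≢ c → b ≢ d →
  Gap n (crossParity a b c d)
gap-oriented {a} {b} {c} {d} a<b c<d b<n d<n a≢c a≢d b≢c b≢d with <-cmp a c
... | tri< a<c _ _ = gap-ordered a<b c<d a<c b<n d<n b≢c b≢d
... | tri≈ _ a≡c _ = ⊥-elim (a≢c a≡c)
... | tri> _ _ c<a = gap-resp (crossParity-swap a b c d)
                       (gap-ordered c<d a<b c<a d<n b<n (a≢d ∘ sym) (b≢d ∘ sym))

gap-disjoint : a < n → b < n → c < n → d < n → a ≢ b → c ≢ d →
  a ≢ c → a ≢ d → b ≢ c → b ≢ d → Gap n (crossParity a b c d)
gap-disjoint {a} {n} {b} {c} {d} a<n b<n c<n d<n a≢b c≢d a≢c a≢d b≢c b≢d with <-cmp a b | <-cmp c d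
... | tri≈ _ a≡b _ | _            = ⊥-elim (a≢b a≡b)
... | _            | tri≈ _ c≡d _ = ⊥-elim (c≢d c≡d)
... | tri< a<b _ _ | tri< c<d _ _ = gap-oriented a<b c<d b<n d<n a≢c a≢d b≢c b≢d
... | tri< a<b _ _ | tri> _ _ d<c =
  gap-resp (crossParity-flipʳ a b c d) (gap-oriented a<b d<c b<n c<n a≢d a≢c b≢d b≢c)
... | tri> _ _ b<a | tri< c<d _ _ =
  gap-resp (crossParity-flipˡ a b c d) (gap-oriented b<a c<d a<n d<n b≢c b≢d a≢c a≢d)
... | tri> _ _ b<a | tri> _ _ d<c =
  gap-resp (λ J → trans (crossParity-flipˡ a b c d J) (crossParity-flipʳ b a c d J))
           (gap-oriented b<a d<c a<n c<n b≢d b≢c a≢d a≢c)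

edgeSum∉C : a < n → b < n → c < n → d < n → a ≢ b → c ≢ d →
  a ≢ c → a ≢ d → b ≢ c → b ≢ d → ¬ C (n ∸ 1) (edgeCode n a b ⊕ edgeCode n c d)
edgeSum∉C a<n b<n c<n d<n a≢b c≢d a≢c a≢d b≢c b≢d =
  gap⇒¬C _ (edgeSum-lookup a<n b<n c<n d<n) (gap-disjoint a<n b<n c<n d<n a≢b c≢d a≢c a≢d b≢c b≢d)

SamePair : ℕ → ℕ → ℕ → ℕ → Set
SamePair a b w x = (a ≡ w × b ≡ x) ⊎ (a ≡ x × b ≡ w)

edgeCode-samePair : ∀ n → SamePair a b w x → edgeCode n a b ≡ edgeCode n w x
edgeCode-samePair n (inj₁ (refl , refl)) = refl
edgeCode-samePair {a} {b} n (inj₂ (refl , refl)) = edgeCode-sym n a b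

samePair-bounds : a < n → b < n → SamePair a b w x → w < n × x < n
samePair-bounds a<n b<n (inj₁ (refl , refl)) = a<n , b<n
samePair-bounds a<n b<n (inj₂ (refl , refl)) = b<n , a<n

samePair-∈ : SamePair a b w x → x ∈ a ∷ b ∷ []
samePair-∈ (inj₁ (_ , refl)) = there (here refl)
samePair-∈ (inj₂ (refl , _)) = here refl

inter-first : ∀ {i j r s} → (i ≡ r) ⊎ (i ≡ s) → ¬ ((j ≡ r) ⊎ (j ≡ s)) → inter i j r s ≡ i ∷ []
inter-first {i} {j} {r} {s} i∈ j∉ =
  trans (filter-accept (λ x → (x ≟ r) ⊎-dec (x ≟ s)) i∈) (cong (i ∷_) (filter-reject (λ x → (x ≟ r) ⊎-dec (x ≟ s)) j∉))

inter-second : ∀ {i j r s} → ¬ ((i ≡ r) ⊎ (i ≡ s)) → (j ≡ r) ⊎ (j ≡ s) → inter i j r s ≡ j ∷ []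
inter-second {i} {j} {r} {s} i∉ j∈ =
  trans (filter-reject (λ x → (x ≟ r) ⊎-dec (x ≟ s)) i∉) (filter-accept (λ x → (x ≟ r) ⊎-dec (x ≟ s)) j∈)

inter-none : ∀ {i j r s} → ¬ ((i ≡ r) ⊎ (i ≡ s)) → ¬ ((j ≡ r) ⊎ (j ≡ s)) → inter i j r s ≡ []
inter-none {i} {j} {r} {s} i∉ j∉ =
  trans (filter-reject (λ x → (x ≟ r) ⊎-dec (x ≟ s)) i∉) (filter-reject (λ x → (x ≟ r) ⊎-dec (x ≟ s)) j∉)

data Overlap (i j r s : ℕ) : Set where
  disjoint : inter i j r s ≡ [] → i ≢ r → i ≢ s → j ≢ r → j ≢ s → Overlap i j r s
  shared   : ∀ w x y → inter i j r s ≡ w ∷ [] → SamePair i j w x → SamePair r s w y →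
             x ≢ w → y ≢ w → x ≢ y → Overlap i j r s
  same     : SamePair i j r s → Overlap i j r s

classify : ∀ i j r s → i ≢ j → r ≢ s → Overlap i j r s
classify i j r s i≢j r≢s with i ≟ r | i ≟ s | j ≟ r | j ≟ s
... | yes i≡r | _       | _       | yes j≡s = same (inj₁ (i≡r , j≡s))
... | _       | yes i≡s | yes j≡r | _       = same (inj₂ (i≡s , j≡r))
... | yes i≡r | _       | yes j≡r | _       = ⊥-elim (i≢j (trans i≡r (sym j≡r)))
... | _       | yes i≡s | _       | yes j≡s = ⊥-elim (i≢j (trans i≡s (sym j≡s)))
... | yes refl | _      | no j≢r  | no j≢s  =
  shared i j s (inter-first (inj₁ refl) [ j≢r , j≢s ]) (inj₁ (refl , refl)) (inj₁ (refl , refl))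
         (i≢j ∘ sym) (r≢s ∘ sym) j≢s
... | _       | yes refl | no j≢r | no j≢s  =
  shared i j r (inter-first (inj₂ refl) [ j≢r , j≢s ]) (inj₁ (refl , refl)) (inj₂ (refl , refl))
         (i≢j ∘ sym) r≢s j≢r
... | no i≢r  | no i≢s  | yes refl | _      =
  shared j i s (inter-second [ i≢r , i≢s ] (inj₁ refl)) (inj₂ (refl , refl)) (inj₁ (refl , refl))
         i≢j (r≢s ∘ sym) i≢s
... | no i≢r  | no i≢s  | _       | yes refl =
  shared j i r (inter-second [ i≢r , i≢s ] (inj₂ refl)) (inj₂ (refl , refl)) (inj₂ (refl , refl))
         i≢j r≢s i≢r
... | no i≢r  | no i≢s  | no j≢r  | no j≢s  =
  disjoint (inter-none [ i≢r , i≢s ] [ j≢r , j≢s ]) i≢r i≢s j≢r j≢s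

Conclusion : (n i j r s : ℕ) → Z2vec n → Set
Conclusion n i j r s v =
  (C (n ∸ 1) v ⇔ length (inter i j r s) ≡ 1) ×
  (length (inter i j r s) ≡ 1 →
    ∃[ x ] ∃[ y ] (x ∈ i ∷ j ∷ [] × y ∈ r ∷ s ∷ [] × x ∉ inter i j r s × y ∉ inter i j r s ×
      [ n ] v ∼∣10^ x -10^ y ∣))

∉-singleton : x ≢ w → x ∉ w ∷ []
∉-singleton x≢w (here x≡w) = x≢w x≡w

-- Disjoint edges: the intersection is empty and the sum is not in C, so
-- both sides of the equivalence fail and the second claim is vacuous.
conclusion-disjoint : ∀ {n i j r s v} → inter i j r s ≡ [] → ¬ C (n ∸ 1) v → Conclusion n i j r s v
conclusion-disjoint {i = i} {j} {r} {s} inter≡[] v∉C =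
  mk⇔ (⊥-elim ∘ v∉C) (⊥-elim ∘ length≢1) , ⊥-elim ∘ length≢1
  where
  length≢1 : length (inter i j r s) ≢ 1
  length≢1 len = 0≢1+n (trans (cong length (sym inter≡[])) len)

-- Edges w—x and w—y with exactly one common endpoint: the sum is the code
-- of the proper edge x—y, which lies in C.
conclusion-shared : ∀ {n i j r s w x y} → i < n → j < n → r < n → s < n →
  inter i j r s ≡ w ∷ [] → SamePair i j w x → SamePair r s w y → x ≢ w → y ≢ w → x ≢ y →
  Conclusion n i j r s (edgeCode n i j ⊕ edgeCode n r s)
conclusion-shared {n} {i} {j} {r} {s} {w} {x} {y} i<n j<n r<n s<n inter≡w ij=wx rs=wy x≢w y≢w x≢y =
  mk⇔ (λ _ → cong length inter≡w) (λ _ → subst (C (n ∸ 1)) (sym sum≡xy) (edgeCode∈C x<n y<n x≢y)) ,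
  λ _ → x , y , samePair-∈ ij=wx , samePair-∈ rs=wy , outside x≢w , outside y≢w ,
        x<n , y<n , x≢y , sum≡xy
  where
  w<n = proj₁ (samePair-bounds i<n j<n ij=wx)
  x<n = proj₂ (samePair-bounds i<n j<n ij=wx)
  y<n = proj₂ (samePair-bounds r<n s<n rs=wy)
  sum≡xy : edgeCode n i j ⊕ edgeCode n r s ≡ edgeCode n x y
  sum≡xy = trans (cong₂ _⊕_ (edgeCode-samePair n ij=wx) (edgeCode-samePair n rs=wy))
                 (edgeCode-shared w<n x<n y<n)
  outside : ∀ {z} → z ≢ w → z ∉ inter i j r s
  outside z≢w z∈ = ∉-singleton z≢w (subst (_ ∈_) inter≡w z∈)

corollary9 : (n : ℕ) → 2 Data.Nat.≤ n → (i j r s : ℕ) → i < n → j < n → r < n → s < n →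
    ¬ (i ≡ j) → ¬ (r ≡ s) → (p q : Z2vec n) →
    [ n ] p ∼∣10^ i -10^ j ∣ → [ n ] q ∼∣10^ r -10^ s ∣ → ¬ (p ≡ q) →
    (C (n ∸ 1) (p ⊕ q) ⇔ length (inter i j r s) ≡ 1) ×
    (length (inter i j r s) ≡ 1 →
      ∃[ x ] ∃[ y ] (x ∈ i ∷ j ∷ [] × y ∈ r ∷ s ∷ [] × x ∉ inter i j r s × y ∉ inter i j r s ×
        [ n ] (p ⊕ q) ∼∣10^ x -10^ y ∣))
corollary9 n _ i j r s i<n j<n r<n s<n i≢j r≢s _ _ (_ , _ , _ , refl) (_ , _ , _ , refl) p≢q
  with classify i j r s i≢j r≢s
... | disjoint inter≡[] i≢r i≢s j≢r j≢s =
  conclusion-disjoint inter≡[] (edgeSum∉C i<n j<n r<n s<n i≢j r≢s i≢r i≢s j≢r j≢s)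
... | shared w x y inter≡w ij=wx rs=wy x≢w y≢w x≢y =
  conclusion-shared i<n j<n r<n s<n inter≡w ij=wx rs=wy x≢w y≢w x≢y
... | same ij=rs = ⊥-elim (p≢q (edgeCode-samePair n ij=rs))
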